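{- (Provable in $\mathbf{RCA}_0$.) Let $X$ be a linear order. Every decomposable element $\gamma$ of $\varphi(1+X)0$ can be written uniquely as $\gamma=\omega^\alpha+\beta$ with $\alpha,\beta\in\varphi(1+X)0$ and $\alpha,\beta<\omega^\alpha+\beta$. Furthermore $L^\varphi_X(\alpha)<L^\varphi_X(\omega^\alpha+\beta)$ and $L^\varphi_X(\beta)<L^\varphi_X(\omega^\alpha+\beta)$ for any such decomposition.
   Context: The notation system $\varphi(1+X)0$: terms and a height function $h$ with values in $1+X$ (elements written $\bot$ for the least element and $1+x$ for $x\in X$) are generated simultaneously with the order: $0$ is a term, $h(0)=\bot$; if $x\in1+X$ and $h(\alpha)\le x$ then $\varphi_x\alpha$ is a term with $h(\varphi_x\alpha)=x$; if $n>1$ and $\varphi_{x_n}\alpha_n\le\dots\le\varphi_{x_1}\alpha_1$ then $\varphi_{x_1}\alpha_1+\dots+\varphi_{x_n}\alpha_n$ is a term with $h=\bot$. Treating $\varphi_x\alpha$ as a one-summand sum, the order is: $0<\gamma$ for $\gamma\neq0$; sums are compared lexicographically by their summand sequences (proper initial segments smaller); $\varphi_x\alpha<\varphi_y\beta$ iff either $x<y$ and $\alpha<\varphi_y\beta$, or $x=y$ and $\alpha<\beta$, or $y<x$ and $\varphi_x\alpha<\beta$. Addition: $0$ is neutral, and $(\gamma_1+\dots+\gamma_k)+(\delta_1+\dots+\delta_m)=\gamma_1+\dots+\gamma_i+\delta_1+\dots+\delta_m$ (all $\gamma_j,\delta_j$ of the form $\varphi_y\zeta$), with $i$ maximal such that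 $\delta_1\le\gamma_i$. Exponentiation: $\omega^\alpha=\alpha$ if $\alpha=\varphi_{1+x}\beta$ for some $x\in X$, and $\omega^\alpha=\varphi_\bot\alpha$ otherwise. An element is decomposable if it is not $0$ and not of the form $\varphi_{1+x}\alpha$ with $x\in X$. Length: $L^\varphi_X(0)=0$ and $L^\varphi_X(\varphi_{x_1}\alpha_1+\dots+\varphi_{x_n}\alpha_n)=L^\varphi_X(\alpha_1)+\dots+L^\varphi_X(\alpha_n)+n$ (including $n=1$). -}

module Defs where

open import Level using (0ℓ)
open import Data.Bool using (Bool; true; false; _∧_; _∨_; not; T)
open import Data.Nat using (ℕ; zero; suc; _+_)
open import Relation.Binary using (Rel; IsStrictTotalOrder; tri<; tri≈; tri>)
open import Relation.Binary.PropositionalEquality using (_≡_)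
open import Relation.Nullary using (¬_)
open import Data.Empty using (⊥)
open import Data.Unit using (⊤)
open import Data.Product using (_×_; Σ)

module Phi {X : Set} {_<X_ : Rel X 0ℓ} (sto : IsStrictTotalOrder _≡_ _<X_) where

  open IsStrictTotalOrder sto using (compare)

  -- 1+X : ⊥ is the least element, 1+ x for x ∈ X
  data H : Set where
    ⊥H : H
    1+_ : X → H

  data Cmp : Set where
    LT EQ GT : Cmp

  cmpH : H → H → Cmp
  cmpH ⊥H ⊥H = EQ
  cmpH ⊥H (1+ _) = LT
  cmpH (1+ _) ⊥H = GT
  cmpH (1+ x) (1+ y) with compare x y
  ... | tri< _ _ _ = LT
  ... | tri≈ _ _ _ = EQ
  ... | tri> _ _ _ = GT

  leH : H → H → Bool
  leH x y with cmpH x y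
  ... | GT = false
  ... | _  = true

  eqH : H → H → Bool
  eqH x y with cmpH x y
  ... | EQ = true
  ... | _  = false

  -- Raw syntax.  A term is a (possibly empty) list of summands φ_x α;
  -- the empty list is 0, a one-element list is φ_x α, and a list of
  -- length n > 1 is the sum φ_{x1}α1 + ... + φ_{xn}αn.
  mutual
    data Tm : Set where
      nil : Tm
      _∷_ : Sm → Tm → Tm

    data Sm : Set where
      φ : H → Tm → Sm

  mutual
    eqT : Tm → Tm → Bool
    eqT nil nil = true
    eqT nil (_ ∷ _) = false
    eqT (_ ∷ _) nil = false
    eqT (s ∷ r) (u ∷ q) = eqS s u ∧ eqT r q

    eqS : Sm → Sm → Bool
    eqS (φ x α) (φ y β) = eqH x y ∧ eqT α β

  hd : Sm → H
  hd (φ x _) = x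

  nonEmpty : Tm → Bool
  nonEmpty nil = false
  nonEmpty (_ ∷ _) = true

  -- The order.  ltT is the order on terms (0 least, sums lexicographic);
  -- ltS compares single summands φ_x α < φ_y β by the three clauses;
  -- ltTS α s  is  α < (s as a one-summand term),
  -- ltST s β  is  (s as a one-summand term) < β,
  -- both being the lexicographic comparison unfolded for a one-element list.
  mutual
    ltT : Tm → Tm → Bool
    ltT nil nil = false
    ltT nil (_ ∷ _) = true
    ltT (_ ∷ _) nil = false
    ltT (s ∷ r) (u ∷ q) = ltS s u ∨ (eqS s u ∧ ltT r q)

    ltS : Sm → Sm → Bool
    ltS a b = ltS' (cmpH (hd a) (hd b)) a b

    ltS' : Cmp → Sm → Sm → Bool
    ltS' LT (φ x α) b = ltTS α b
    ltS' EQ (φ x α) (φ y β) = ltT α β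
    ltS' GT a (φ y β) = ltST a β

    -- α < (s ∷ nil):  nil < anything nonempty; (t ∷ r) < (s ∷ nil) iff
    -- t < s or (t = s and r < nil), and r < nil is false.
    ltTS : Tm → Sm → Bool
    ltTS nil s = true
    ltTS (t ∷ r) s = ltS t s

    -- (s ∷ nil) < β:  iff β = u ∷ q with s < u or (s = u and nil < q).
    ltST : Sm → Tm → Bool
    ltST s nil = false
    ltST s (u ∷ q) = ltS s u ∨ (eqS s u ∧ nonEmpty q)

  infix 4 _<_
  _<_ : Tm → Tm → Set
  α < β = T (ltT α β)

  leS : Sm → Sm → Bool
  leS s u = ltS s u ∨ eqS s u

  h : Tm → H
  h nil = ⊥H
  h (φ x α ∷ nil) = x
  h (_ ∷ (_ ∷ _)) = ⊥H

  mutual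
    WF : Tm → Set
    WF nil = ⊤
    WF (s ∷ r) = WFS s × WFTail s r

    WFS : Sm → Set
    WFS (φ x α) = WF α × T (leH (h α) x)

    WFTail : Sm → Tm → Set
    WFTail s nil = ⊤
    WFTail s (u ∷ q) = T (leS u s) × WFS u × WFTail u q

  -- addition: keep γ₁ … γᵢ with i maximal such that δ₁ ≤ γᵢ
  keep : Tm → Sm → Tm
  keep nil d = nil
  keep (g ∷ gs) d with keep gs d
  ... | u ∷ us = g ∷ (u ∷ us)
  ... | nil with leS d g
  ...   | true  = g ∷ nil
  ...   | false = nil

  _++T_ : Tm → Tm → Tm
  nil ++T q = q
  (s ∷ r) ++T q = s ∷ (r ++T q)

  infixl 6 _⊕_
  _⊕_ : Tm → Tm → Tm
  γ ⊕ nil = γ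
  γ ⊕ (d ∷ ds) = keep γ d ++T (d ∷ ds)

  ω^ : Tm → Tm
  ω^ (φ (1+ x) β ∷ nil) = φ (1+ x) β ∷ nil
  ω^ nil = φ ⊥H nil ∷ nil
  ω^ (φ ⊥H β ∷ nil) = φ ⊥H (φ ⊥H β ∷ nil) ∷ nil
  ω^ (s ∷ (u ∷ q)) = φ ⊥H (s ∷ (u ∷ q)) ∷ nil

  Decomposable : Tm → Set
  Decomposable γ = ¬ (γ ≡ nil) × (∀ (x : X) (α : Tm) → ¬ (γ ≡ φ (1+ x) α ∷ nil))

  mutual
    L : Tm → ℕ
    L nil = 0
    L (s ∷ r) = LS s + L r

    LS : Sm → ℕ
    LS (φ x α) = L α + 1

-- ω^α is always a single summand, namely φ_⊥ α unless α is itself some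
-- φ_{1+x} β.  Hence γ = s + r decomposes as ω^α + β with ω^α = s and β = r,
-- and β < ω^α + β forces the sum not to absorb ω^α, so ω^α + β is literally
-- the term with head ω^α and tail β; uniqueness then follows since ω^ has a
-- left inverse on summands, and the length bounds are immediate.
module Submission where

open import Defs
open import Level using (0ℓ)
open import Relation.Binary using (Rel; IsStrictTotalOrder; tri<; tri≈; tri>)
open import Relation.Binary.PropositionalEquality
  using (_≡_; refl; sym; trans; cong; subst; module ≡-Reasoning)
open import Relation.Nullary using (¬_)
open import Data.Bool using (true; false; T)
open import Data.Bool.Properties using (T-∨; T-∧)
open import Data.Empty using (⊥-elim)
open import Data.Unit using (tt)
open import Data.Sum using (inj₁; inj₂)
open import Data.Product using (Σ; _×_; _,_; proj₂)
open import Data.Nat using (z<s) renaming (_<_ to _<ℕ_)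
open import Data.Nat.Properties using (m<m+n; m<n+m; m≤m+n; <-≤-trans; +-monoʳ-<)
open import Function.Bundles using (Equivalence)

open Equivalence using (to; from)

module Decomposition {X : Set} {_<X_ : Rel X 0ℓ} (sto : IsStrictTotalOrder _≡_ _<X_) where
  open Defs.Phi sto
  open IsStrictTotalOrder sto using (compare)

  cmpH-refl : ∀ x → cmpH x x ≡ EQ
  cmpH-refl ⊥H = refl
  cmpH-refl (1+ x) with compare x x
  ... | tri< _ x≢x _ = ⊥-elim (x≢x refl)
  ... | tri≈ _ _ _ = refl
  ... | tri> _ x≢x _ = ⊥-elim (x≢x refl)

  eqH-refl : ∀ x → T (eqH x x)
  eqH-refl x rewrite cmpH-refl x = tt

  mutual
    eqT-refl : ∀ t → T (eqT t t)
    eqT-refl nil = tt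
    eqT-refl (s ∷ r) = from T-∧ (eqS-refl s , eqT-refl r)

    eqS-refl : ∀ s → T (eqS s s)
    eqS-refl (φ x α) = from T-∧ (eqH-refl x , eqT-refl α)

  ∷-<-head : ∀ s u r q → T (ltS s u) → s ∷ r < u ∷ q
  ∷-<-head s u _ _ s<u = from (T-∨ {ltS s u}) (inj₁ s<u)

  ∷-<-tail : ∀ s u r q → T (eqS s u) → r < q → s ∷ r < u ∷ q
  ∷-<-tail s u _ _ s=u r<q = from (T-∨ {ltS s u}) (inj₂ (from T-∧ (s=u , r<q)))

  mutual
    <-irrefl : ∀ t → ¬ t < t
    <-irrefl nil ()
    <-irrefl (s ∷ r) s∷r<s∷r with to (T-∨ {ltS s s}) s∷r<s∷r
    ... | inj₁ s<s = ltS-irrefl s s<s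
    ... | inj₂ s=s×r<r = <-irrefl r (proj₂ (to (T-∧ {eqS s s}) s=s×r<r))

    ltS-irrefl : ∀ s → ¬ T (ltS s s)
    ltS-irrefl (φ x α) rewrite cmpH-refl x = <-irrefl α

  tail<term : ∀ s r → WFTail s r → r < s ∷ r
  tail<term s nil _ = tt
  tail<term s (u ∷ q) (u≤s , _ , q-tail) with to (T-∨ {ltS u s}) u≤s
  ... | inj₁ u<s = ∷-<-head u s q (u ∷ q) u<s
  ... | inj₂ u=s = ∷-<-tail u s q (u ∷ q) u=s (tail<term u q q-tail)

  WFTail⇒WF : ∀ {s} r → WFTail s r → WF r
  WFTail⇒WF nil _ = tt
  WFTail⇒WF (u ∷ q) (_ , wfu , q-tail) = wfu , q-tail

  -- A leading φ_{1+x} ε in α forces α to be a proper sum (h α = ⊥), and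
  -- φ_{1+x} ε < φ_⊥ α then reduces to φ_{1+x} ε < α.
  <-φ⊥ : ∀ α r → WF α → T (leH (h α) ⊥H) → α < φ ⊥H α ∷ r
  <-φ⊥ nil r _ _ = tt
  <-φ⊥ (φ ⊥H ε ∷ q) r ((wfε , hε≤⊥) , _) _ =
    ∷-<-head (φ ⊥H ε) (φ ⊥H (φ ⊥H ε ∷ q)) q r (<-φ⊥ ε q wfε hε≤⊥)
  <-φ⊥ (φ (1+ x) ε ∷ nil) r _ ()
  <-φ⊥ (s@(φ (1+ x) ε) ∷ (u ∷ q)) r _ _ =
    ∷-<-head s (φ ⊥H (s ∷ (u ∷ q))) (u ∷ q) r (∷-<-tail s s nil (u ∷ q) (eqS-refl s) tt)

  ω^-of-height-⊥ : ∀ α → T (leH (h α) ⊥H) → ω^ α ≡ φ ⊥H α ∷ nil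
  ω^-of-height-⊥ nil _ = refl
  ω^-of-height-⊥ (φ ⊥H β ∷ nil) _ = refl
  ω^-of-height-⊥ (φ (1+ x) β ∷ nil) ()
  ω^-of-height-⊥ (φ ⊥H _ ∷ (_ ∷ _)) _ = refl
  ω^-of-height-⊥ (φ (1+ _) _ ∷ (_ ∷ _)) _ = refl

  singleton⊕ : ∀ s r → WFTail s r → (s ∷ nil) ⊕ r ≡ s ∷ r
  singleton⊕ s nil _ = refl
  singleton⊕ s (u ∷ q) (u≤s , _) with leS u s
  ... | true = refl
  ... | false = ⊥-elim u≤s

  -- If u ≤ s fails, the sum drops s and equals its right summand.
  singleton⊕-unabsorbed : ∀ s r → r < (s ∷ nil) ⊕ r → (s ∷ nil) ⊕ r ≡ s ∷ r
  singleton⊕-unabsorbed s nil _ = refl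
  singleton⊕-unabsorbed s (u ∷ q) r<sum with leS u s
  ... | true = refl
  ... | false = ⊥-elim (<-irrefl (u ∷ q) r<sum)

  ω^-summand : Tm → Sm
  ω^-summand (φ (1+ x) β ∷ nil) = φ (1+ x) β
  ω^-summand nil = φ ⊥H nil
  ω^-summand (φ ⊥H β ∷ nil) = φ ⊥H (φ ⊥H β ∷ nil)
  ω^-summand (s ∷ (u ∷ q)) = φ ⊥H (s ∷ (u ∷ q))

  ω^≡ω^-summand : ∀ α → ω^ α ≡ ω^-summand α ∷ nil
  ω^≡ω^-summand (φ (1+ x) β ∷ nil) = refl
  ω^≡ω^-summand nil = refl
  ω^≡ω^-summand (φ ⊥H β ∷ nil) = refl
  ω^≡ω^-summand (φ ⊥H _ ∷ (_ ∷ _)) = refl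
  ω^≡ω^-summand (φ (1+ _) _ ∷ (_ ∷ _)) = refl

  log : Sm → Tm
  log (φ ⊥H α) = α
  log (φ (1+ x) α) = φ (1+ x) α ∷ nil

  log-ω^-summand : ∀ α → log (ω^-summand α) ≡ α
  log-ω^-summand (φ (1+ x) β ∷ nil) = refl
  log-ω^-summand nil = refl
  log-ω^-summand (φ ⊥H β ∷ nil) = refl
  log-ω^-summand (φ ⊥H _ ∷ (_ ∷ _)) = refl
  log-ω^-summand (φ (1+ _) _ ∷ (_ ∷ _)) = refl

  ω^-summand-injective : ∀ {α α′} → ω^-summand α ≡ ω^-summand α′ → α ≡ α′
  ω^-summand-injective {α} {α′} e = begin
    α                      ≡⟨ sym (log-ω^-summand α) ⟩
    log (ω^-summand α)     ≡⟨ cong log e ⟩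
    log (ω^-summand α′)    ≡⟨ log-ω^-summand α′ ⟩
    α′                     ∎
    where open ≡-Reasoning

  ω^⊕≡∷ : ∀ α β → β < ω^ α ⊕ β → ω^ α ⊕ β ≡ ω^-summand α ∷ β
  ω^⊕≡∷ α β rewrite ω^≡ω^-summand α = singleton⊕-unabsorbed (ω^-summand α) β

  ∷-injective : ∀ {s u r q} → s ∷ r ≡ u ∷ q → s ≡ u × r ≡ q
  ∷-injective refl = refl , refl

  ω^⊕-unique : ∀ {α β α′ β′} → β < ω^ α ⊕ β → β′ < ω^ α′ ⊕ β′ →
    ω^ α ⊕ β ≡ ω^ α′ ⊕ β′ → α ≡ α′ × β ≡ β′
  ω^⊕-unique {α} {β} {α′} {β′} β< β′< e with ∷-injective
    (trans (sym (ω^⊕≡∷ α β β<)) (trans e (ω^⊕≡∷ α′ β′ β′<)))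
  ... | heads , tails = ω^-summand-injective heads , tails

  exponent-of-head : ∀ s r → WFS s → WFTail s r → Decomposable (s ∷ r) →
    Σ Tm λ α → WF α × ω^ α ≡ s ∷ nil × α < s ∷ r
  exponent-of-head (φ ⊥H α) r (wfα , hα≤⊥) _ _ =
    α , wfα , ω^-of-height-⊥ α hα≤⊥ , <-φ⊥ α r wfα hα≤⊥
  exponent-of-head (φ (1+ x) β) nil _ _ (_ , not-φ₁₊ₓ) = ⊥-elim (not-φ₁₊ₓ x β refl)
  exponent-of-head s@(φ (1+ x) β) (u ∷ q) wfs _ _ =
    s ∷ nil , (wfs , tt) , refl , ∷-<-tail s s nil (u ∷ q) (eqS-refl s) tt

  decomposition : ∀ γ → WF γ → Decomposable γ →
    Σ Tm λ α → Σ Tm λ β →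
      WF α × WF β × γ ≡ ω^ α ⊕ β × α < ω^ α ⊕ β × β < ω^ α ⊕ β
  decomposition nil _ (γ≢0 , _) = ⊥-elim (γ≢0 refl)
  decomposition (s ∷ r) (wfs , r-tail) dec with exponent-of-head s r wfs r-tail dec
  ... | α , wfα , ω^α≡s , α<γ =
    α , r , wfα , WFTail⇒WF r r-tail , sym sum≡γ ,
    subst (α <_) (sym sum≡γ) α<γ , subst (r <_) (sym sum≡γ) (tail<term s r r-tail)
    where
    sum≡γ : ω^ α ⊕ r ≡ s ∷ r
    sum≡γ = trans (cong (_⊕ r) ω^α≡s) (singleton⊕ s r r-tail)

  L-exponent<LS : ∀ x α → L α <ℕ LS (φ x α)
  L-exponent<LS x α = m<m+n (L α) z<s

  L-head-exponent< : ∀ x α r → L α <ℕ L (φ x α ∷ r)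
  L-head-exponent< x α r = <-≤-trans (L-exponent<LS x α) (m≤m+n (LS (φ x α)) (L r))

  L-tail< : ∀ s r → L r <ℕ L (s ∷ r)
  L-tail< (φ x α) r = m<n+m (L r) (<-≤-trans z<s (L-exponent<LS x α))

  L-exponent< : ∀ α β → Decomposable (ω^-summand α ∷ β) → L α <ℕ L (ω^-summand α ∷ β)
  L-exponent< (φ (1+ x) b ∷ nil) nil (_ , not-φ₁₊ₓ) = ⊥-elim (not-φ₁₊ₓ x b refl)
  L-exponent< (φ (1+ x) b ∷ nil) (u ∷ q) _ =
    +-monoʳ-< (LS (φ (1+ x) b)) (<-≤-trans z<s (L-tail< u q))
  L-exponent< nil β _ = L-head-exponent< ⊥H nil β
  L-exponent< α@(φ ⊥H _ ∷ nil) β _ = L-head-exponent< ⊥H α β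
  L-exponent< α@(φ ⊥H _ ∷ (_ ∷ _)) β _ = L-head-exponent< ⊥H α β
  L-exponent< α@(φ (1+ _) _ ∷ (_ ∷ _)) β _ = L-head-exponent< ⊥H α β

  L-ω^⊕ : ∀ α β → Decomposable (ω^ α ⊕ β) → β < ω^ α ⊕ β →
    L α <ℕ L (ω^ α ⊕ β) × L β <ℕ L (ω^ α ⊕ β)
  L-ω^⊕ α β dec β< = subst (λ t → L α <ℕ L t × L β <ℕ L t) (sym sum≡∷)
    (L-exponent< α β (subst Decomposable sum≡∷ dec) , L-tail< (ω^-summand α) β)
    where
    sum≡∷ : ω^ α ⊕ β ≡ ω^-summand α ∷ β
    sum≡∷ = ω^⊕≡∷ α β β<

lemma3p2 : {X : Set} {_<X_ : Rel X 0ℓ} (sto : IsStrictTotalOrder _≡_ _<X_) →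
    let open Defs.Phi sto in
    (γ : Tm) → WF γ → Decomposable γ →
      (Σ Tm λ α → Σ Tm λ β →
        WF α × WF β × γ ≡ ω^ α ⊕ β × α < ω^ α ⊕ β × β < ω^ α ⊕ β)
      × (∀ α β α′ β′ → WF α → WF β → WF α′ → WF β′ →
          γ ≡ ω^ α ⊕ β → α < ω^ α ⊕ β → β < ω^ α ⊕ β →
          γ ≡ ω^ α′ ⊕ β′ → α′ < ω^ α′ ⊕ β′ → β′ < ω^ α′ ⊕ β′ →
          α ≡ α′ × β ≡ β′)
      × (∀ α β → WF α → WF β →
          γ ≡ ω^ α ⊕ β → α < ω^ α ⊕ β → β < ω^ α ⊕ β →
          L α <ℕ L (ω^ α ⊕ β) × L β <ℕ L (ω^ α ⊕ β))
lemma3p2 sto γ wf dec =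
  decomposition γ wf dec ,
  (λ _ _ _ _ _ _ _ _ e _ β< e′ _ β′< → ω^⊕-unique β< β′< (trans (sym e) e′)) ,
  (λ α β _ _ e _ β< → L-ω^⊕ α β (subst Decomposable e dec) β<)
  where
  open Defs.Phi sto
  open Decomposition sto
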